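{- Let $G$ be a directed acyclic graph with $m$ edges, $s$ a vertex, $t$ a sink vertex, and $\varepsilon>0$. For arbitrary initial register values, the value $N_{\mathrm{reach}}/K$ returned by $\mathrm{Walk}(G,s,t,\varepsilon)$ is within additive error $\varepsilon$ of $p_t$, the probability that a random walk from $s$ reaches $t$.
   Context: A random walk from $s$ repeatedly moves along a uniformly random outgoing edge of the current vertex until reaching a sink (out-degree $0$). Let $K=\lceil 2m/\varepsilon\rceil$ and $\ell=\lceil\log_2 K\rceil$. The catalytic tape holds one $\ell$-bit register $R_v\in\{0,\dots,2^\ell-1\}$ per vertex $v$, with arbitrary initial content. $d_{\mathrm{out}}(v)$ is the out-degree of $v$ and its out-edges are indexed $0,\dots,d_{\mathrm{out}}(v)-1$. Procedure $\mathrm{WalkOnce}(G,s,\mathrm{mode})$: set $v\gets s$; while $d_{\mathrm{out}}(v)>0$: if mode is Fwd, set $r\gets R_v \bmod d_{\mathrm{out}}(v)$ then $R_v\gets(R_v+1)\bmod 2^\ell$; if mode is Rev, set $R_v\gets (R_v-1)\bmod 2^\ell$ then $r\gets R_v\bmod d_{\mathrm{out}}(v)$; then set $v$ to the endpoint of the $r$-th out-edge of $v$. Return $v$. Procedure $\mathrm{Walk}(G,s,t,\varepsilon)$: forward phase: run $\mathrm{WalkOnce}(G,s,\mathrm{Fwd})$ $K$ times, letting $N_{\mathrm{reach}}$ be the number of runs returning $t$; reverse phase: run $\mathrm{WalkOnce}(G,s,\mathrm{Rev})$ $K$ times; return $N_{\mathrm{reach}}/K$. -}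

module Defs where

open import Data.Nat as ℕ using (ℕ; zero; suc; _+_; _*_; _∸_; _^_; _%_; NonZero)
open import Data.Nat.DivMod using (m%n<n)
open import Data.Nat.Logarithm using (⌈log₂_⌉)
open import Data.Integer as ℤ using (ℤ; +_)
open import Data.Rational as ℚ using (ℚ; 0ℚ; 1ℚ; _÷_; >-nonZero; ceiling)
open import Data.Fin using (Fin; fromℕ<)
open import Data.List using (List; []; _∷_; length; map; allFin; lookup)
open import Data.Nat.ListAction using (sum)
open import Data.List.Membership.Propositional using (_∈_)
open import Data.Product using (_×_; _,_; proj₁)
open import Relation.Nullary using (¬_; yes; no)
open import Relation.Binary.PropositionalEquality using (_≡_)
open import Data.Fin.Properties using (_≟_)

-- A finite directed multigraph on vertex set Fin n: out v is the list of
-- out-edges of v; its i-th entry is the endpoint of the i-th out-edge.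
record Graph (n : ℕ) : Set where
  field
    out : Fin n → List (Fin n)
open Graph public

dout : ∀ {n} → Graph n → Fin n → ℕ
dout G v = length (out G v)

edges : ∀ {n} → Graph n → ℕ
edges {n} G = sum (map (dout G) (allFin n))

Sink : ∀ {n} → Graph n → Fin n → Set
Sink G v = out G v ≡ []

Edge : ∀ {n} → Graph n → Fin n → Fin n → Set
Edge G u w = w ∈ out G u

data Path {n} (G : Graph n) : Fin n → Fin n → Set where
  edge : ∀ {u w} → Edge G u w → Path G u w
  _◅_  : ∀ {u v w} → Edge G u v → Path G v w → Path G u w

Acyclic : ∀ {n} → Graph n → Set
Acyclic {n} G = (v : Fin n) → ¬ Path G v v

-- Random-walk probabilities.
-- reachProb G t k v = probability that the random walk started at v
-- has reached t within k steps (t a sink, so reaching t = stopping at t).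

indicator : ∀ {n} → Fin n → Fin n → ℚ
indicator v t with v ≟ t
... | yes _ = 1ℚ
... | no  _ = 0ℚ

sumℚ : List ℚ → ℚ
sumℚ []       = 0ℚ
sumℚ (x ∷ xs) = x ℚ.+ sumℚ xs

reachProb : ∀ {n} → Graph n → Fin n → ℕ → Fin n → ℚ
reachProb G t zero    v = indicator v t
reachProb G t (suc k) v with out G v
... | []     = indicator v t
... | e ∷ es = sumℚ (map (reachProb G t k) (e ∷ es)) ℚ.* (+ 1 ℚ./ suc (length es))

-- p_t : probability that the random walk from s reaches t.  In a DAG on n
-- vertices every walk stops after at most n - 1 steps, so n steps suffice.
pReach : ∀ {n} → Graph n → Fin n → Fin n → ℚ
pReach {n} G s t = reachProb G t n s

Kpar : ∀ {n} → Graph n → (ε : ℚ) → ε ℚ.> 0ℚ → ℕ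
Kpar G ε ε>0 = ℤ.∣ ceiling (_÷_ (+ (2 * edges G) ℚ./ 1) ε {{>-nonZero ε>0}}) ∣

ℓpar : ∀ {n} → Graph n → (ε : ℚ) → ε ℚ.> 0ℚ → ℕ
ℓpar G ε ε>0 = ⌈log₂ Kpar G ε ε>0 ⌉

-- Catalytic registers: one ℓ-bit register per vertex, values in [0, 2^ℓ).

Registers : ℕ → Set
Registers n = Fin n → ℕ

update : ∀ {n} → Registers n → Fin n → ℕ → Registers n
update R v x w with w ≟ v
... | yes _ = x
... | no  _ = R w

-- (x + 1) mod M  and  (x - 1) mod M  for 0 ≤ x < M
incMod : ℕ → ℕ → ℕ
incMod M x with M
... | zero  = x
... | suc M' = (x + 1) % suc M'

decMod : ℕ → ℕ → ℕ
decMod M zero    = M ∸ 1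
decMod M (suc x) = x

data Mode : Set where
  Fwd Rev : Mode

pick : ∀ {n} (e : Fin n) (es : List (Fin n)) → ℕ → Fin n
pick e es x = lookup (e ∷ es) (fromℕ< (m%n<n x (suc (length es))))

stepAt : ∀ {n} → ℕ → Mode → Registers n → Fin n → Fin n → List (Fin n)
       → Registers n × Fin n
stepAt M Fwd R v e es = update R v (incMod M (R v)) , pick e es (R v)
stepAt M Rev R v e es = update R v (decMod M (R v)) , pick e es (decMod M (R v))

-- WalkOnce with a fuel bound (the number of vertices suffices in a DAG,
-- since every walk reaches a sink after at most n - 1 steps).
walkOnceFuel : ∀ {n} → Graph n → ℕ → Mode → ℕ → Registers n → Fin n
             → Registers n × Fin n
walkOnceFuel G M mode zero    R v = R , v
walkOnceFuel G M mode (suc f) R v with out G v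
... | []     = R , v
... | e ∷ es with stepAt M mode R v e es
...   | R' , v' = walkOnceFuel G M mode f R' v'

walkOnce : ∀ {n} → Graph n → ℕ → Mode → Registers n → Fin n → Registers n × Fin n
walkOnce {n} G M mode R s = walkOnceFuel G M mode n R s

forwardPhase : ∀ {n} → Graph n → ℕ → Fin n → Fin n → ℕ → Registers n
             → Registers n × ℕ
forwardPhase G M s t zero    R = R , 0
forwardPhase G M s t (suc k) R with walkOnce G M Fwd R s
... | R' , v with forwardPhase G M s t k R'
...   | R'' , N = R'' , (indicatorℕ v t + N)
  where
  indicatorℕ : ∀ {n} → Fin n → Fin n → ℕ
  indicatorℕ v t with v ≟ t
  ... | yes _ = 1
  ... | no  _ = 0

reversePhase : ∀ {n} → Graph n → ℕ → Fin n → ℕ → Registers n → Registers n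
reversePhase G M s zero    R = R
reversePhase G M s (suc k) R = reversePhase G M s k (proj₁ (walkOnce G M Rev R s))

-- N / K as a rational (K = 0 is excluded by the theorem's hypotheses)
ratio : ℕ → ℕ → ℚ
ratio N zero    = 0ℚ
ratio N (suc k) = + N ℚ./ suc k

walk : ∀ {n} → Graph n → Fin n → Fin n → (ε : ℚ) → ε ℚ.> 0ℚ → Registers n
     → ℚ × Registers n
walk G s t ε ε>0 R₀ with forwardPhase G (2 ^ ℓpar G ε ε>0) s t (Kpar G ε ε>0) R₀
... | R₁ , N = ratio N (Kpar G ε ε>0)
             , reversePhase G (2 ^ ℓpar G ε ε>0) s (Kpar G ε ε>0) R₁

walkValue : ∀ {n} → Graph n → Fin n → Fin n → (ε : ℚ) → ε ℚ.> 0ℚ → Registers n → ℚ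
walkValue G s t ε ε>0 R₀ = proj₁ (walk G s t ε ε>0 R₀)

-- Let h v = pReach G v t: at a sink h v is [v = t], elsewhere it is the average of h over
-- the out-edges of v. Read each register as the residue mod M = 2^ℓ of an unbounded counter
-- and give vertex v the potential Φ v u = Σ_{j<u} (h w_j − h v), where w_j is the
-- out-neighbour chosen when the counter of v is j; let Ψ be the sum of Φ v at the current
-- counters. A step v → w raises Ψ by exactly h w − h v, so the indicator that a run from s
-- ends at t is h s plus the increase of Ψ, and summing over the K runs gives
-- N_reach = K h s + ΔΨ. The choices at v cycle through its d_v out-edges, whose h-values
-- average to h v, so the partial sums defining Φ v stay in an interval of width d_v. A run
-- raises each counter by at most one, so over K ≤ M runs each residue wraps at most once and
-- Φ v moves by at most 2 d_v. Hence |N_reach − K h s| ≤ 2m ≤ εK.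

module Submission where

open import Defs

open import Data.Empty using (⊥-elim)
open import Data.Fin as Fin using (Fin; fromℕ<)
import Data.Fin.Properties as FinP
open import Data.Integer as ℤ using (+_)
import Data.Integer.DivMod as ℤD
import Data.Integer.Properties as ℤP
import Data.Integer.Tactic.RingSolver as ℤRing
open import Data.List as List using (List; []; _∷_; map; length; allFin)
open import Data.List.Membership.Propositional using (_∈_; find)
open import Data.List.Membership.Propositional.Properties using (∈-lookup; ∈-allFin)
open import Data.List.Relation.Unary.All as All using (All; []; _∷_)
open import Data.List.Relation.Unary.AllPairs using (_∷_)
open import Data.List.Relation.Unary.Any using (Any; here; there)
open import Data.List.Relation.Unary.Unique.Propositional using (Unique)
open import Data.List.Relation.Unary.Unique.Propositional.Properties using (allFin⁺)
open import Data.Nat as ℕ using (ℕ; zero; suc; _<_; _^_; _%_; NonZero; z≤n; s≤s; ⌈_/2⌉; ⌊_/2⌋)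
import Data.Nat.DivMod as ℕD
open import Data.Nat.Induction using (<-rec)
open import Data.Nat.ListAction using (sum)
open import Data.Nat.Logarithm using (⌈log₂_⌉; ⌈log₂⌉-mono-≤; ⌈log₂2^n⌉≡n; ⌈log₂⌈n/2⌉⌉≡⌈log₂n⌉∸1)
import Data.Nat.Properties as ℕP
open import Data.Product using (Σ; _×_; _,_; proj₁; proj₂)
open import Data.Rational as ℚ using (ℚ; 0ℚ; 1ℚ; _+_; _*_; _-_; -_; _≤_; _>_; ∣_∣; _/_; ↥_; ↧_; floor; ceiling; toℚᵘ)
import Data.Rational.Properties as ℚP
open import Data.Rational.Unnormalised as ℚᵘ using (mkℚᵘ; *≡*) renaming (_≃_ to _≃ᵘ_)
import Data.Rational.Unnormalised.Properties as ℚᵘP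
open import Data.Sum using (_⊎_; inj₁; inj₂)
open import Function using (_∘_)
open import Level using (0ℓ)
open import Relation.Binary.PropositionalEquality
open import Relation.Nullary using (Dec; yes; no; ¬_)
open import Relation.Nullary.Decidable using (dec⇒maybe)
open import Tactic.RingSolver using (solve-∀)
open import Tactic.RingSolver.Core.AlmostCommutativeRing using (AlmostCommutativeRing; fromCommutativeRing)

ℚ-ring : AlmostCommutativeRing 0ℓ 0ℓ
ℚ-ring = fromCommutativeRing ℚP.+-*-commutativeRing (λ x → dec⇒maybe (0ℚ ℚP.≟ x))

fromℕ : ℕ → ℚ
fromℕ k = + k / 1

toℚᵘ-/ : ∀ i k → toℚᵘ (i / suc k) ≃ᵘ mkℚᵘ i k
toℚᵘ-/ i k = ℚP.toℚᵘ-fromℚᵘ (mkℚᵘ i k)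

fromℕ-+ : ∀ a b → fromℕ (a ℕ.+ b) ≡ fromℕ a + fromℕ b
fromℕ-+ a b = ℚP.toℚᵘ-injective (begin
  toℚᵘ (fromℕ (a ℕ.+ b))
    ≈⟨ toℚᵘ-/ (+ (a ℕ.+ b)) 0 ⟩
  mkℚᵘ (+ (a ℕ.+ b)) 0
    ≈⟨ *≡* (trans (cong (ℤ._* (+ 1 ℤ.* + 1)) (ℤP.pos-+ a b)) (cross-multiplied (+ a) (+ b))) ⟩
  mkℚᵘ (+ a) 0 ℚᵘ.+ mkℚᵘ (+ b) 0
    ≈⟨ ℚᵘP.+-cong (toℚᵘ-/ (+ a) 0) (toℚᵘ-/ (+ b) 0) ⟨
  toℚᵘ (fromℕ a) ℚᵘ.+ toℚᵘ (fromℕ b)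
    ≈⟨ ℚP.toℚᵘ-homo-+ (fromℕ a) (fromℕ b) ⟨
  toℚᵘ (fromℕ a + fromℕ b) ∎)
  where
  open ℚᵘP.≃-Reasoning
  cross-multiplied : ∀ x y → (x ℤ.+ y) ℤ.* (+ 1 ℤ.* + 1) ≡ (x ℤ.* + 1 ℤ.+ y ℤ.* + 1) ℤ.* + 1
  cross-multiplied = ℤRing.solve-∀

fromℕ-nonNeg : ∀ k → 0ℚ ≤ fromℕ k
fromℕ-nonNeg k = ℚP.nonNegative⁻¹ (fromℕ k) {{ℚP.normalize-nonNeg k 1}}

fromℕ-mono-≤ : ∀ {a b} → a ℕ.≤ b → fromℕ a ≤ fromℕ b
fromℕ-mono-≤ {a} {b} a≤b = begin
  fromℕ a                    ≡⟨ ℚP.+-identityʳ (fromℕ a) ⟨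
  fromℕ a + 0ℚ               ≤⟨ ℚP.+-monoʳ-≤ (fromℕ a) (fromℕ-nonNeg (b ℕ.∸ a)) ⟩
  fromℕ a + fromℕ (b ℕ.∸ a)  ≡⟨ fromℕ-+ a (b ℕ.∸ a) ⟨
  fromℕ (a ℕ.+ (b ℕ.∸ a))    ≡⟨ cong fromℕ (ℕP.m+[n∸m]≡n a≤b) ⟩
  fromℕ b                    ∎
  where open ℚP.≤-Reasoning

n/d≡n*1/d : ∀ n k → + n / suc k ≡ fromℕ n * (+ 1 / suc k)
n/d≡n*1/d n k = ℚP.toℚᵘ-injective (begin
  toℚᵘ (+ n / suc k)
    ≈⟨ toℚᵘ-/ (+ n) k ⟩
  mkℚᵘ (+ n) k
    ≈⟨ *≡* (cong₂ (λ x d → x ℤ.* + suc d) (sym (ℤP.*-identityʳ (+ n))) (ℕP.+-identityʳ k)) ⟩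
  mkℚᵘ (+ n) 0 ℚᵘ.* mkℚᵘ (+ 1) k
    ≈⟨ ℚᵘP.*-cong (toℚᵘ-/ (+ n) 0) (toℚᵘ-/ (+ 1) k) ⟨
  toℚᵘ (fromℕ n) ℚᵘ.* toℚᵘ (+ 1 / suc k)
    ≈⟨ ℚP.toℚᵘ-homo-* (fromℕ n) (+ 1 / suc k) ⟨
  toℚᵘ (fromℕ n * (+ 1 / suc k)) ∎)
  where open ℚᵘP.≃-Reasoning

d*1/d≡1 : ∀ k → fromℕ (suc k) * (+ 1 / suc k) ≡ 1ℚ
d*1/d≡1 k = trans (sym (n/d≡n*1/d (suc k) k)) (ℚP.toℚᵘ-injective
  (ℚᵘP.≃-trans (toℚᵘ-/ (+ suc k) k) (*≡* (ℤP.*-comm (+ suc k) (+ 1)))))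

floor*↧≤↥ : ∀ p → floor p ℤ.* ↧ p ℤ.≤ ↥ p
floor*↧≤↥ p@record{} = subst (floor p ℤ.* ↧ p ℤ.≤_) (sym (ℤD.a≡a%n+[a/n]*n (↥ p) (↧ p)))
                          (ℤP.i≤j+i _ (+ (↥ p ℤD.% ↧ p)))

↥≤ceiling*↧ : ∀ p → ↥ p ℤ.≤ ceiling p ℤ.* ↧ p
↥≤ceiling*↧ p@record{} = begin
  ↥ p                            ≡⟨ ℤP.neg-involutive (↥ p) ⟨
  ℤ.- (ℤ.- ↥ p)                  ≡⟨ cong ℤ.-_ (ℚP.↥-neg p) ⟨
  ℤ.- (↥ (- p))                  ≤⟨ ℤP.neg-mono-≤ (floor*↧≤↥ (- p)) ⟩
  ℤ.- (floor (- p) ℤ.* ↧ (- p))  ≡⟨ ℤP.neg-distribˡ-* (floor (- p)) (↧ (- p)) ⟩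
  ℤ.- floor (- p) ℤ.* ↧ (- p)    ≡⟨ cong (ℤ.- floor (- p) ℤ.*_) (ℚP.↧-neg p) ⟩
  ceiling p ℤ.* ↧ p              ∎
  where open ℤP.≤-Reasoning

p≤∣ceiling-p∣ : ∀ {p} → 0ℚ ≤ p → p ≤ fromℕ ℤ.∣ ceiling p ∣
p≤∣ceiling-p∣ {p@(ℚ.mkℚ _ _ _)} 0≤p = ℚP.toℚᵘ-cancel-≤
  (ℚᵘP.≤-respʳ-≃ (ℚᵘP.≃-sym (toℚᵘ-/ (+ ℤ.∣ ceiling p ∣) 0)) (ℚᵘ.*≤* ↥p≤∣ceiling-p∣*↧p))
  where
  0≤ceiling-p : ℤ.0ℤ ℤ.≤ ceiling p
  0≤ceiling-p = ℤP.*-cancelʳ-≤-pos ℤ.0ℤ (ceiling p) (↧ p)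
    (ℤP.≤-trans (ℤP.nonNegative⁻¹ (↥ p) {{ℚ.nonNegative 0≤p}}) (↥≤ceiling*↧ p))
  ↥p≤∣ceiling-p∣*↧p : ↥ p ℤ.* + 1 ℤ.≤ + ℤ.∣ ceiling p ∣ ℤ.* ↧ p
  ↥p≤∣ceiling-p∣*↧p = subst₂ ℤ._≤_ (sym (ℤP.*-identityʳ (↥ p)))
    (cong (ℤ._* ↧ p) (sym (ℤP.0≤i⇒+∣i∣≡i 0≤ceiling-p))) (↥≤ceiling*↧ p)

x≤ε*∣ceiling[x÷ε]∣ : ∀ {x ε} (ε>0 : ε > 0ℚ) → 0ℚ ≤ x
                   → x ≤ ε * fromℕ ℤ.∣ ceiling ((x ℚ.÷ ε) {{ℚ.>-nonZero ε>0}}) ∣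
x≤ε*∣ceiling[x÷ε]∣ {x} {ε} ε>0 0≤x = begin
  x                                   ≡⟨ x≡ε*[x/ε] ⟩
  ε * (x * 1/ε)                       ≤⟨ ℚP.*-monoˡ-≤-nonNeg ε (p≤∣ceiling-p∣ 0≤x/ε) ⟩
  ε * fromℕ ℤ.∣ ceiling (x * 1/ε) ∣   ∎
  where
  open ℚP.≤-Reasoning
  instance
    ε-nonZero : ℚ.NonZero ε
    ε-nonZero = ℚ.>-nonZero ε>0
    ε-positive : ℚ.Positive ε
    ε-positive = ℚ.positive ε>0
    ε-nonNeg : ℚ.NonNegative ε
    ε-nonNeg = ℚP.pos⇒nonNeg ε
  1/ε = ℚ.1/ ε
  rearrange : ∀ x ε y → x * (ε * y) ≡ ε * (x * y)
  rearrange = solve-∀ ℚ-ring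
  x≡ε*[x/ε] : x ≡ ε * (x * 1/ε)
  x≡ε*[x/ε] = trans (sym (ℚP.*-identityʳ x))
                (trans (cong (x *_) (sym (ℚP.*-inverseʳ ε))) (rearrange x ε 1/ε))
  0≤x/ε : 0ℚ ≤ x * 1/ε
  0≤x/ε = ℚP.*-cancelˡ-≤-pos ε (subst₂ _≤_ (sym (ℚP.*-zeroʳ ε)) x≡ε*[x/ε] 0≤x)

∣p∣≤q : ∀ {p q} → p ≤ q → - p ≤ q → ∣ p ∣ ≤ q
∣p∣≤q {p} p≤q -p≤q with ℚP.∣p∣≡p∨∣p∣≡-p p
... | inj₁ ∣p∣≡p  = subst (_≤ _) (sym ∣p∣≡p) p≤q
... | inj₂ ∣p∣≡-p = subst (_≤ _) (sym ∣p∣≡-p) -p≤q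

∣p-q∣≤w : ∀ {l w p q} → l ≤ p → p ≤ l + w → l ≤ q → q ≤ l + w → ∣ p - q ∣ ≤ w
∣p-q∣≤w {l} {w} {p} {q} l≤p p≤l+w l≤q q≤l+w =
  ∣p∣≤q (difference≤w p≤l+w l≤q) (subst (_≤ w) (neg-difference q p) (difference≤w q≤l+w l≤p))
  where
  neg-difference : ∀ x y → x - y ≡ - (y - x)
  neg-difference = solve-∀ ℚ-ring
  cancel : ∀ a b → (a + b) - a ≡ b
  cancel = solve-∀ ℚ-ring
  difference≤w : ∀ {x y} → x ≤ l + w → l ≤ y → x - y ≤ w
  difference≤w {x} {y} x≤l+w l≤y = begin
    x - y        ≤⟨ ℚP.+-mono-≤ x≤l+w (ℚP.neg-antimono-≤ l≤y) ⟩
    (l + w) - l  ≡⟨ cancel l w ⟩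
    w            ∎
    where open ℚP.≤-Reasoning

ratio-∸ : ∀ N k p → ratio N (suc k) - p ≡ (fromℕ N - fromℕ (suc k) * p) * (+ 1 / suc k)
ratio-∸ N k p = begin
  ratio N (suc k) - p          ≡⟨ cong (_- p) (n/d≡n*1/d N k) ⟩
  fromℕ N * c - p              ≡⟨ cong (λ x → fromℕ N * c - x) p≡p*[K*c] ⟩
  fromℕ N * c - p * (K * c)    ≡⟨ factor (fromℕ N) p K c ⟩
  (fromℕ N - K * p) * c        ∎
  where
  open ≡-Reasoning
  K = fromℕ (suc k)
  c = + 1 / suc k
  p≡p*[K*c] : p ≡ p * (K * c)
  p≡p*[K*c] = sym (trans (cong (p *_) (d*1/d≡1 k)) (ℚP.*-identityʳ p))
  factor : ∀ n p K c → n * c - p * (K * c) ≡ (n - K * p) * c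
  factor = solve-∀ ℚ-ring

ratio-error : ∀ N k p ε → ∣ fromℕ N - fromℕ (suc k) * p ∣ ≤ ε * fromℕ (suc k)
            → ∣ ratio N (suc k) - p ∣ ≤ ε
ratio-error N k p ε error≤εK = begin
  ∣ ratio N (suc k) - p ∣  ≡⟨ cong ∣_∣ (ratio-∸ N k p) ⟩
  ∣ D * c ∣                ≡⟨ ℚP.∣p*q∣≡∣p∣*∣q∣ D c ⟩
  ∣ D ∣ * ∣ c ∣            ≡⟨ cong (∣ D ∣ *_) (ℚP.0≤p⇒∣p∣≡p (ℚP.nonNegative⁻¹ c)) ⟩
  ∣ D ∣ * c                ≤⟨ ℚP.*-monoʳ-≤-nonNeg c error≤εK ⟩
  ε * K * c                ≡⟨ ℚP.*-assoc ε K c ⟩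
  ε * (K * c)              ≡⟨ cong (ε *_) (d*1/d≡1 k) ⟩
  ε * 1ℚ                   ≡⟨ ℚP.*-identityʳ ε ⟩
  ε                        ∎
  where
  open ℚP.≤-Reasoning
  K = fromℕ (suc k)
  c = + 1 / suc k
  instance
    c≥0 : ℚ.NonNegative c
    c≥0 = ℚP.normalize-nonNeg 1 (suc k)
  D = fromℕ N - K * p

n≤2^⌈log₂n⌉ : ∀ n → n ℕ.≤ 2 ^ ⌈log₂ n ⌉
n≤2^⌈log₂n⌉ = <-rec (λ n → n ℕ.≤ 2 ^ ⌈log₂ n ⌉) step
  where
  step : ∀ n → (∀ {m} → m < n → m ℕ.≤ 2 ^ ⌈log₂ m ⌉) → n ℕ.≤ 2 ^ ⌈log₂ n ⌉
  step zero          _  = z≤n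
  step (suc zero)    _  = ℕP.m^n>0 2 ⌈log₂ 1 ⌉
  step n@(suc (suc k)) rec = begin
    n                       ≡⟨ ℕP.⌊n/2⌋+⌈n/2⌉≡n n ⟨
    ⌊ n /2⌋ ℕ.+ ⌈ n /2⌉      ≤⟨ ℕP.+-monoˡ-≤ ⌈ n /2⌉ (ℕP.⌊n/2⌋≤⌈n/2⌉ n) ⟩
    ⌈ n /2⌉ ℕ.+ ⌈ n /2⌉      ≤⟨ ℕP.+-mono-≤ half≤P half≤P ⟩
    P ℕ.+ P                 ≡⟨ cong (P ℕ.+_) (ℕP.+-identityʳ P) ⟨
    2 ^ suc L               ≡⟨ cong (2 ^_) 1+L≡⌈log₂n⌉ ⟩
    2 ^ ⌈log₂ n ⌉           ∎
    where
    open ℕP.≤-Reasoning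
    L = ⌈log₂ ⌈ n /2⌉ ⌉
    P = 2 ^ L
    half≤P : ⌈ n /2⌉ ℕ.≤ P
    half≤P = rec (ℕP.⌈n/2⌉<n k)
    1≤⌈log₂n⌉ : 1 ℕ.≤ ⌈log₂ n ⌉
    1≤⌈log₂n⌉ = subst (ℕ._≤ ⌈log₂ n ⌉) (⌈log₂2^n⌉≡n 1) (⌈log₂⌉-mono-≤ {2} {n} (s≤s (s≤s z≤n)))
    1+L≡⌈log₂n⌉ : suc L ≡ ⌈log₂ n ⌉
    1+L≡⌈log₂n⌉ = trans (cong suc (⌈log₂⌈n/2⌉⌉≡⌈log₂n⌉∸1 n)) (ℕP.m+[n∸m]≡n 1≤⌈log₂n⌉)

-- Finite sums

sumTo : (ℕ → ℚ) → ℕ → ℚ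
sumTo f zero    = 0ℚ
sumTo f (suc k) = f 0 + sumTo (f ∘ suc) k

sumTo-cong : ∀ {f g} k → (∀ {j} → j < k → f j ≡ g j) → sumTo f k ≡ sumTo g k
sumTo-cong zero    f≡g = refl
sumTo-cong (suc k) f≡g = cong₂ _+_ (f≡g (s≤s z≤n)) (sumTo-cong k (f≡g ∘ s≤s))

sumTo-zero : ∀ k → sumTo (λ _ → 0ℚ) k ≡ 0ℚ
sumTo-zero zero    = refl
sumTo-zero (suc k) = trans (ℚP.+-identityˡ _) (sumTo-zero k)

sumTo-suc : ∀ f k → sumTo f (suc k) ≡ sumTo f k + f k
sumTo-suc f zero    = trans (ℚP.+-identityʳ (f 0)) (sym (ℚP.+-identityˡ (f 0)))
sumTo-suc f (suc k) = trans (cong (_+_ (f 0)) (sumTo-suc (f ∘ suc) k)) (sym (ℚP.+-assoc (f 0) _ _))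

sumTo-+ : ∀ f a b → sumTo f (a ℕ.+ b) ≡ sumTo f a + sumTo (λ j → f (a ℕ.+ j)) b
sumTo-+ f zero    b = sym (ℚP.+-identityˡ _)
sumTo-+ f (suc a) b = trans (cong (_+_ (f 0)) (sumTo-+ (f ∘ suc) a b)) (sym (ℚP.+-assoc (f 0) _ _))

sumTo-∸ : ∀ f c k → sumTo (λ j → f j - c) k ≡ sumTo f k - fromℕ k * c
sumTo-∸ f c zero    = trans (sym (ℚP.+-inverseʳ 0ℚ)) (cong (_-_ 0ℚ) (sym (ℚP.*-zeroˡ c)))
sumTo-∸ f c (suc k) = begin
  (f 0 - c) + sumTo (λ j → f (suc j) - c) k  ≡⟨ cong (_+_ (f 0 - c)) (sumTo-∸ (f ∘ suc) c k) ⟩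
  (f 0 - c) + (S - fromℕ k * c)              ≡⟨ regroup (f 0) c S (fromℕ k) ⟩
  (f 0 + S) - (1ℚ + fromℕ k) * c             ≡⟨ cong (λ x → (f 0 + S) - x * c) (fromℕ-+ 1 k) ⟨
  (f 0 + S) - fromℕ (suc k) * c              ∎
  where
  open ≡-Reasoning
  S = sumTo (f ∘ suc) k
  regroup : ∀ a c s i → (a - c) + (s - i * c) ≡ (a + s) - (1ℚ + i) * c
  regroup = solve-∀ ℚ-ring

sumTo-bounds : ∀ {f} → (∀ j → 0ℚ ≤ f j) → (∀ j → f j ≤ 1ℚ) → ∀ k → 0ℚ ≤ sumTo f k × sumTo f k ≤ fromℕ k
sumTo-bounds 0≤f f≤1 zero    = ℚP.≤-refl , ℚP.≤-refl
sumTo-bounds {f} 0≤f f≤1 (suc k) with sumTo-bounds (0≤f ∘ suc) (f≤1 ∘ suc) k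
... | 0≤S , S≤k = ℚP.+-mono-≤ (0≤f 0) 0≤S
                , subst (sumTo f (suc k) ≤_) (sym (fromℕ-+ 1 k)) (ℚP.+-mono-≤ (f≤1 0) S≤k)

module _ {A : Set} where

  sumℚ-map-cong : ∀ {f g : A → ℚ} {xs} → All (λ x → f x ≡ g x) xs → sumℚ (map f xs) ≡ sumℚ (map g xs)
  sumℚ-map-cong []           = refl
  sumℚ-map-cong (fx≡gx ∷ eqs) = cong₂ _+_ fx≡gx (sumℚ-map-cong eqs)

  sumℚ-map-bounds : ∀ {f : A → ℚ} → (∀ x → 0ℚ ≤ f x) → (∀ x → f x ≤ 1ℚ)
                  → ∀ xs → 0ℚ ≤ sumℚ (map f xs) × sumℚ (map f xs) ≤ fromℕ (length xs)
  sumℚ-map-bounds 0≤f f≤1 []       = ℚP.≤-refl , ℚP.≤-refl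
  sumℚ-map-bounds {f} 0≤f f≤1 (x ∷ xs) with sumℚ-map-bounds 0≤f f≤1 xs
  ... | 0≤S , S≤n = ℚP.+-mono-≤ (0≤f x) 0≤S
                  , subst (sumℚ (map f (x ∷ xs)) ≤_) (sym (fromℕ-+ 1 (length xs))) (ℚP.+-mono-≤ (f≤1 x) S≤n)

  sumℚ-map-update : ∀ {f g : A → ℚ} {v δ xs} → Unique xs → v ∈ xs
                  → g v ≡ f v + δ → (∀ {w} → w ≢ v → g w ≡ f w)
                  → sumℚ (map g xs) ≡ sumℚ (map f xs) + δ
  sumℚ-map-update {f} {g} {v} {δ} {_ ∷ xs} (v∉xs ∷ _) (here refl) gv≡fv+δ g≡f = begin
    g v + sumℚ (map g xs)         ≡⟨ cong₂ _+_ gv≡fv+δ (sumℚ-map-cong (All.map (λ v≢w → g≡f (v≢w ∘ sym)) v∉xs)) ⟩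
    (f v + δ) + sumℚ (map f xs)   ≡⟨ swap (f v) δ (sumℚ (map f xs)) ⟩
    (f v + sumℚ (map f xs)) + δ   ∎
    where
    open ≡-Reasoning
    swap : ∀ a b c → (a + b) + c ≡ (a + c) + b
    swap = solve-∀ ℚ-ring
  sumℚ-map-update {f} {g} {v} {δ} {x ∷ xs} (x∉xs ∷ unique) (there v∈xs) gv≡fv+δ g≡f = begin
    g x + sumℚ (map g xs)         ≡⟨ cong₂ _+_ (g≡f x≢v) (sumℚ-map-update unique v∈xs gv≡fv+δ g≡f) ⟩
    f x + (sumℚ (map f xs) + δ)   ≡⟨ ℚP.+-assoc (f x) (sumℚ (map f xs)) δ ⟨
    (f x + sumℚ (map f xs)) + δ   ∎
    where
    open ≡-Reasoning
    x≢v : x ≢ v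
    x≢v = All.lookup x∉xs v∈xs

  ∣sumℚ-map-∸∣≤ : ∀ {f g : A → ℚ} (c : A → ℕ) → (∀ x → ∣ f x - g x ∣ ≤ fromℕ (c x))
                → ∀ xs → ∣ sumℚ (map f xs) - sumℚ (map g xs) ∣ ≤ fromℕ (sum (map c xs))
  ∣sumℚ-map-∸∣≤ c ∣f-g∣≤c []       = ℚP.≤-refl
  ∣sumℚ-map-∸∣≤ {f} {g} c ∣f-g∣≤c (x ∷ xs) = begin
    ∣ (f x + F) - (g x + G) ∣          ≡⟨ cong ∣_∣ (regroup (f x) F (g x) G) ⟩
    ∣ (f x - g x) + (F - G) ∣          ≤⟨ ℚP.∣p+q∣≤∣p∣+∣q∣ (f x - g x) (F - G) ⟩
    ∣ f x - g x ∣ + ∣ F - G ∣          ≤⟨ ℚP.+-mono-≤ (∣f-g∣≤c x) (∣sumℚ-map-∸∣≤ c ∣f-g∣≤c xs) ⟩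
    fromℕ (c x) + fromℕ (sum (map c xs)) ≡⟨ fromℕ-+ (c x) _ ⟨
    fromℕ (sum (map c (x ∷ xs)))       ∎
    where
    open ℚP.≤-Reasoning
    F = sumℚ (map f xs)
    G = sumℚ (map g xs)
    regroup : ∀ a s b r → (a + s) - (b + r) ≡ (a - b) + (s - r)
    regroup = solve-∀ ℚ-ring

  sumTo≡sumℚ-map : ∀ (f : A → ℚ) (g : ℕ → A) xs
                 → (∀ {j} (j<n : j < length xs) → g j ≡ List.lookup xs (fromℕ< j<n))
                 → sumTo (f ∘ g) (length xs) ≡ sumℚ (map f xs)
  sumTo≡sumℚ-map f g []       g≡lookup = refl
  sumTo≡sumℚ-map f g (x ∷ xs) g≡lookup =
    cong₂ _+_ (cong f (g≡lookup (s≤s z≤n))) (sumTo≡sumℚ-map f (g ∘ suc) xs (g≡lookup ∘ s≤s))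

sum-map-*ˡ : ∀ {A : Set} k (f : A → ℕ) xs → sum (map (λ x → k ℕ.* f x) xs) ≡ k ℕ.* sum (map f xs)
sum-map-*ˡ k f []       = sym (ℕP.*-zeroʳ k)
sum-map-*ˡ k f (x ∷ xs) = trans (cong (k ℕ.* f x ℕ.+_) (sum-map-*ˡ k f xs)) (sym (ℕP.*-distribˡ-+ k (f x) _))

-- Partial sums of a periodic sequence

module _ (a : ℕ → ℚ) (μ : ℚ) where

  deviation : ℕ → ℚ
  deviation = sumTo (λ j → a j - μ)

  wrappedDeviation : (M : ℕ) .{{_ : NonZero M}} → ℕ → ℚ
  wrappedDeviation M = sumTo (λ j → a (j % M) - μ)

  module _ (d : ℕ) .{{_ : NonZero d}}
           (a-periodic : ∀ j → a (d ℕ.+ j) ≡ a j) (sum-a≡d*μ : sumTo a d ≡ fromℕ d * μ)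
           (0≤a : ∀ j → 0ℚ ≤ a j) (a≤1 : ∀ j → a j ≤ 1ℚ) (0≤μ : 0ℚ ≤ μ) (μ≤1 : μ ≤ 1ℚ)
    where

    deviation-d : deviation d ≡ 0ℚ
    deviation-d = trans (sumTo-∸ a μ d)
                        (trans (cong (_- fromℕ d * μ) sum-a≡d*μ) (ℚP.+-inverseʳ (fromℕ d * μ)))

    deviation-periodic : ∀ q y → deviation (q ℕ.* d ℕ.+ y) ≡ deviation y
    deviation-periodic zero    y = refl
    deviation-periodic (suc q) y = begin
      deviation (d ℕ.+ q ℕ.* d ℕ.+ y)
        ≡⟨ cong deviation (ℕP.+-assoc d (q ℕ.* d) y) ⟩
      deviation (d ℕ.+ (q ℕ.* d ℕ.+ y))
        ≡⟨ sumTo-+ (λ j → a j - μ) d (q ℕ.* d ℕ.+ y) ⟩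
      deviation d + sumTo (λ j → a (d ℕ.+ j) - μ) (q ℕ.* d ℕ.+ y)
        ≡⟨ cong₂ _+_ deviation-d (sumTo-cong (q ℕ.* d ℕ.+ y) (λ {j} _ → cong (_- μ) (a-periodic j))) ⟩
      0ℚ + deviation (q ℕ.* d ℕ.+ y)
        ≡⟨ ℚP.+-identityˡ (deviation (q ℕ.* d ℕ.+ y)) ⟩
      deviation (q ℕ.* d ℕ.+ y)
        ≡⟨ deviation-periodic q y ⟩
      deviation y ∎
      where open ≡-Reasoning

    deviation-% : ∀ x → deviation x ≡ deviation (x % d)
    deviation-% x = trans (cong deviation x≡[x/d]*d+x%d) (deviation-periodic (x ℕ./ d) (x % d))
      where
      x≡[x/d]*d+x%d : x ≡ x ℕ./ d ℕ.* d ℕ.+ x % d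
      x≡[x/d]*d+x%d = trans (ℕD.m≡m%n+[m/n]*n x d) (ℕP.+-comm (x % d) _)

    private
      D = fromℕ d
      instance
        μ-nonNeg : ℚ.NonNegative μ
        μ-nonNeg = ℚ.nonNegative 0≤μ
        1-μ-nonNeg : ℚ.NonNegative (1ℚ - μ)
        1-μ-nonNeg = ℚ.nonNegative (subst (_≤ 1ℚ - μ) (ℚP.+-inverseʳ μ) (ℚP.+-monoˡ-≤ (- μ) μ≤1))

    deviation-lower-≤d : ∀ {r} → r ℕ.≤ d → - (D * μ) ≤ deviation r
    deviation-lower-≤d {r} r≤d = begin
      - (D * μ)    ≤⟨ ℚP.neg-antimono-≤ (ℚP.*-monoʳ-≤-nonNeg μ (fromℕ-mono-≤ r≤d)) ⟩
      - (R * μ)    ≡⟨ ℚP.+-identityˡ (- (R * μ)) ⟨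
      0ℚ - R * μ   ≤⟨ ℚP.+-monoˡ-≤ (- (R * μ)) (proj₁ (sumTo-bounds 0≤a a≤1 r)) ⟩
      S - R * μ    ≡⟨ sumTo-∸ a μ r ⟨
      deviation r  ∎
      where
      open ℚP.≤-Reasoning
      R = fromℕ r
      S = sumTo a r

    deviation-upper-≤d : ∀ {r} → r ℕ.≤ d → deviation r ≤ - (D * μ) + D
    deviation-upper-≤d {r} r≤d = begin
      deviation r   ≡⟨ sumTo-∸ a μ r ⟩
      S - R * μ     ≤⟨ ℚP.+-monoˡ-≤ (- (R * μ)) (proj₂ (sumTo-bounds 0≤a a≤1 r)) ⟩
      R - R * μ     ≡⟨ factor R μ ⟩
      R * (1ℚ - μ)  ≤⟨ ℚP.*-monoʳ-≤-nonNeg (1ℚ - μ) (fromℕ-mono-≤ r≤d) ⟩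
      D * (1ℚ - μ)  ≡⟨ expand D μ ⟩
      - (D * μ) + D ∎
      where
      open ℚP.≤-Reasoning
      R = fromℕ r
      S = sumTo a r
      factor : ∀ r μ → r - r * μ ≡ r * (1ℚ - μ)
      factor = solve-∀ ℚ-ring
      expand : ∀ d μ → d * (1ℚ - μ) ≡ - (d * μ) + d
      expand = solve-∀ ℚ-ring

    ∣deviation-∸∣≤d : ∀ x y → ∣ deviation x - deviation y ∣ ≤ D
    ∣deviation-∸∣≤d x y = subst₂ (λ p q → ∣ p - q ∣ ≤ D) (sym (deviation-% x)) (sym (deviation-% y))
      (∣p-q∣≤w (deviation-lower-≤d (%d≤d x)) (deviation-upper-≤d (%d≤d x))
               (deviation-lower-≤d (%d≤d y)) (deviation-upper-≤d (%d≤d y)))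
      where
      %d≤d : ∀ z → z % d ℕ.≤ d
      %d≤d z = ℕP.<⇒≤ (ℕD.m%n<n z d)

    module _ (M : ℕ) .{{_ : NonZero M}} where

      wrapped≡deviation : ∀ {x} → x ℕ.≤ M → wrappedDeviation M x ≡ deviation x
      wrapped≡deviation {x} x≤M =
        sumTo-cong x (λ j<x → cong (λ i → a i - μ) (ℕD.m<n⇒m%n≡m (ℕP.<-≤-trans j<x x≤M)))

      wrapped-M+ : ∀ {y} → y ℕ.≤ M → wrappedDeviation M (M ℕ.+ y) ≡ deviation M + deviation y
      wrapped-M+ {y} y≤M = begin
        wrappedDeviation M (M ℕ.+ y)
          ≡⟨ sumTo-+ (λ j → a (j % M) - μ) M y ⟩
        wrappedDeviation M M + sumTo (λ j → a ((M ℕ.+ j) % M) - μ) y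
          ≡⟨ cong (_+_ (wrappedDeviation M M)) (sumTo-cong y (λ {j} _ → cong (λ i → a i - μ) ([M+j]%M≡j%M j))) ⟩
        wrappedDeviation M M + wrappedDeviation M y
          ≡⟨ cong₂ _+_ (wrapped≡deviation ℕP.≤-refl) (wrapped≡deviation y≤M) ⟩
        deviation M + deviation y ∎
        where
        open ≡-Reasoning
        [M+j]%M≡j%M : ∀ j → (M ℕ.+ j) % M ≡ j % M
        [M+j]%M≡j%M j = trans (cong (_% M) (ℕP.+-comm M j)) (ℕD.[m+n]%n≡m%n j M)

      ∣wrapped-∸∣≤2d : ∀ {u₀ u₁} → u₀ < M → u₁ ℕ.≤ u₀ ℕ.+ M
                     → ∣ wrappedDeviation M u₁ - wrappedDeviation M u₀ ∣ ≤ fromℕ (2 ℕ.* d)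
      ∣wrapped-∸∣≤2d {u₀} {u₁} u₀<M u₁≤u₀+M =
        subst (∣ wrappedDeviation M u₁ - wrappedDeviation M u₀ ∣ ≤_) (sym 2d≡d+d) (bound (u₁ ℕ.≤? M))
        where
        open ℚP.≤-Reasoning
        2d≡d+d : fromℕ (2 ℕ.* d) ≡ D + D
        2d≡d+d = trans (fromℕ-+ d (d ℕ.+ 0)) (cong (λ e → D + fromℕ e) (ℕP.+-identityʳ d))
        u₀-wrapped = wrapped≡deviation (ℕP.<⇒≤ u₀<M)
        regroup : ∀ p q r → (p + q) - r ≡ (p - r) + (q - 0ℚ)
        regroup = solve-∀ ℚ-ring
        bound : Dec (u₁ ℕ.≤ M) → ∣ wrappedDeviation M u₁ - wrappedDeviation M u₀ ∣ ≤ D + D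
        bound (yes u₁≤M) = begin
          ∣ wrappedDeviation M u₁ - wrappedDeviation M u₀ ∣
            ≡⟨ cong₂ (λ p q → ∣ p - q ∣) (wrapped≡deviation u₁≤M) u₀-wrapped ⟩
          ∣ deviation u₁ - deviation u₀ ∣
            ≤⟨ ∣deviation-∸∣≤d u₁ u₀ ⟩
          D
            ≡⟨ ℚP.+-identityʳ D ⟨
          D + 0ℚ
            ≤⟨ ℚP.+-monoʳ-≤ D (fromℕ-nonNeg d) ⟩
          D + D ∎
        bound (no u₁≰M) = begin
          ∣ wrappedDeviation M u₁ - wrappedDeviation M u₀ ∣
            ≡⟨ cong (λ u → ∣ wrappedDeviation M u - wrappedDeviation M u₀ ∣) (ℕP.m+[n∸m]≡n M≤u₁) ⟨
          ∣ wrappedDeviation M (M ℕ.+ y) - wrappedDeviation M u₀ ∣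
            ≡⟨ cong₂ (λ p q → ∣ p - q ∣) (wrapped-M+ (ℕP.<⇒≤ (ℕP.≤-<-trans y≤u₀ u₀<M))) u₀-wrapped ⟩
          ∣ (deviation M + deviation y) - deviation u₀ ∣
            ≡⟨ cong ∣_∣ (regroup (deviation M) (deviation y) (deviation u₀)) ⟩
          ∣ (deviation M - deviation u₀) + (deviation y - deviation 0) ∣
            ≤⟨ ℚP.∣p+q∣≤∣p∣+∣q∣ (deviation M - deviation u₀) (deviation y - deviation 0) ⟩
          ∣ deviation M - deviation u₀ ∣ + ∣ deviation y - deviation 0 ∣
            ≤⟨ ℚP.+-mono-≤ (∣deviation-∸∣≤d M u₀) (∣deviation-∸∣≤d y 0) ⟩
          D + D ∎
          where
          y = u₁ ℕ.∸ M
          M≤u₁ = ℕP.<⇒≤ (ℕP.≰⇒> u₁≰M)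
          y≤u₀ : y ℕ.≤ u₀
          y≤u₀ = subst (y ℕ.≤_) (ℕP.m+n∸n≡m u₀ M) (ℕP.∸-monoˡ-≤ M u₁≤u₀+M)

-- Halting and reach probabilities

all⊎any : ∀ {A : Set} {P Q : A → Set} → (∀ x → P x ⊎ Q x) → ∀ xs → All P xs ⊎ Any Q xs
all⊎any p⊎q []       = inj₁ []
all⊎any p⊎q (x ∷ xs) with p⊎q x | all⊎any p⊎q xs
... | inj₁ px | inj₁ all-p = inj₁ (px ∷ all-p)
... | inj₁ _  | inj₂ any-q = inj₂ (there any-q)
... | inj₂ qx | _          = inj₂ (here qx)

module _ {n : ℕ} (G : Graph n) where

  -- Halts k v: every walk from v is at a sink after fewer than k steps, so fuel k suffices.
  data Halts : ℕ → Fin n → Set where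
    halts : ∀ {k v} → All (Halts k) (out G v) → Halts (suc k) v

  WalkFrom : ℕ → Fin n → Set
  WalkFrom k v = Σ (ℕ → Fin n) λ f → f 0 ≡ v × (∀ {i} → i < k → Edge G (f i) (f (suc i)))

  walk-∷ : ∀ {k v w} → Edge G v w → WalkFrom k w → WalkFrom (suc k) v
  walk-∷ {v = v} {w} v→w (f , f0≡w , f-edges) = g , refl , g-edges
    where
    g : ℕ → Fin n
    g zero    = v
    g (suc i) = f i
    g-edges : ∀ {i} → i < suc _ → Edge G (g i) (g (suc i))
    g-edges {zero}  _         = subst (Edge G v) (sym f0≡w) v→w
    g-edges {suc i} (s≤s i<k) = f-edges i<k

  halts⊎walk : ∀ k v → Halts k v ⊎ WalkFrom k v
  halts⊎walk zero    v = inj₂ ((λ _ → v) , refl , λ ())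
  halts⊎walk (suc k) v with all⊎any (halts⊎walk k) (out G v)
  ... | inj₁ all-halt = inj₁ (halts all-halt)
  ... | inj₂ some-walk with find some-walk
  ...   | w , v→w , walk = inj₂ (walk-∷ v→w walk)

  path-∷ʳ : ∀ {u v w} → Path G u v → Edge G v w → Path G u w
  path-∷ʳ (edge u→v)   v→w = u→v ◅ edge v→w
  path-∷ʳ (u→x ◅ x⇝v) v→w = u→x ◅ path-∷ʳ x⇝v v→w

  walk-path : ∀ {k} (f : ℕ → Fin n) → (∀ {i} → i < k → Edge G (f i) (f (suc i)))
            → ∀ {i j} → i < j → j ℕ.≤ k → Path G (f i) (f j)
  walk-path f f-edges {i} {suc j} i<1+j 1+j≤k with ℕP.m<1+n⇒m<n∨m≡n i<1+j
  ... | inj₁ i<j  = path-∷ʳ (walk-path f f-edges i<j (ℕP.<⇒≤ 1+j≤k)) (f-edges 1+j≤k)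
  ... | inj₂ refl = edge (f-edges 1+j≤k)

  acyclic⇒halts : Acyclic G → ∀ v → Halts n v
  acyclic⇒halts acyclic v with halts⊎walk n v
  ... | inj₁ h = h
  ... | inj₂ (f , _ , f-edges) with FinP.pigeonhole (ℕP.n<1+n n) (f ∘ Fin.toℕ)
  ...   | i , j , i<j , fi≡fj = ⊥-elim (acyclic (f (Fin.toℕ i))
            (subst (Path G _) (sym fi≡fj) (walk-path f f-edges i<j (ℕP.≤-pred (FinP.toℕ<n j)))))

indicator-bounds : ∀ {n} (v t : Fin n) → 0ℚ ≤ indicator v t × indicator v t ≤ 1ℚ
indicator-bounds v t with v FinP.≟ t
... | yes _ = ℚP.nonNegative⁻¹ 1ℚ , ℚP.≤-refl
... | no  _ = ℚP.≤-refl , ℚP.nonNegative⁻¹ 1ℚ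

module _ {n : ℕ} (G : Graph n) (t : Fin n) where

  reachProb-sink : ∀ {v} → Sink G v → ∀ k → reachProb G t k v ≡ indicator v t
  reachProb-sink _ zero = refl
  reachProb-sink {v} sink-v (suc k) with out G v
  reachProb-sink refl (suc k) | [] = refl

  reachProb-step : ∀ {v e es} → out G v ≡ e ∷ es → ∀ k
                 → reachProb G t (suc k) v ≡ sumℚ (map (reachProb G t k) (e ∷ es)) * (+ 1 / suc (length es))
  reachProb-step {v} v→es k with out G v
  reachProb-step refl k | _ ∷ _ = refl

  reachProb-bounds : ∀ k v → 0ℚ ≤ reachProb G t k v × reachProb G t k v ≤ 1ℚ
  reachProb-bounds zero    v = indicator-bounds v t
  reachProb-bounds (suc k) v with out G v
  ... | []     = indicator-bounds v t
  ... | e ∷ es = ℚP.≤-trans (ℚP.≤-reflexive (sym (ℚP.*-zeroˡ c))) (ℚP.*-monoʳ-≤-nonNeg c 0≤S)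
               , ℚP.≤-trans (ℚP.*-monoʳ-≤-nonNeg c S≤d) (ℚP.≤-reflexive (d*1/d≡1 (length es)))
    where
    c = + 1 / suc (length es)
    instance
      c-nonNeg : ℚ.NonNegative c
      c-nonNeg = ℚP.normalize-nonNeg 1 (suc (length es))
    S-bounds = sumℚ-map-bounds (proj₁ ∘ reachProb-bounds k) (proj₂ ∘ reachProb-bounds k) (e ∷ es)
    0≤S = proj₁ S-bounds
    S≤d = proj₂ S-bounds

  reachProb-stable : ∀ {k v} → Halts G k v → ∀ j → reachProb G t (j ℕ.+ k) v ≡ reachProb G t k v
  reachProb-stable {suc k} {v} (halts all-halt) j rewrite ℕP.+-suc j k with out G v | all-halt
  ... | []     | _        = refl
  ... | e ∷ es | all-halt′ = cong (_* (+ 1 / suc (length es)))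
                               (sumℚ-map-cong (All.map (λ h → reachProb-stable h j) all-halt′))

pReach-harmonic : ∀ {n} (G : Graph n) → Acyclic G → ∀ t {v e es} → out G v ≡ e ∷ es
                → pReach G v t ≡ sumℚ (map (λ w → pReach G w t) (e ∷ es)) * (+ 1 / suc (length es))
pReach-harmonic {n} G acyclic t {v} v→es =
  trans (sym (reachProb-stable G t (acyclic⇒halts G acyclic v) 1)) (reachProb-step G t v→es n)

-- Runs with unbounded counters

update-≡ : ∀ {n} (R : Registers n) v x → update R v x v ≡ x
update-≡ R v x with v FinP.≟ v
... | yes _   = refl
... | no  v≢v = ⊥-elim (v≢v refl)

update-≢ : ∀ {n} (R : Registers n) {v} x {w} → w ≢ v → update R v x w ≡ R w
update-≢ R {v} x {w} w≢v with w FinP.≟ v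
... | yes w≡v = ⊥-elim (w≢v w≡v)
... | no  _   = refl

incMod-% : ∀ M .{{_ : NonZero M}} x → incMod M (x % M) ≡ suc x % M
incMod-% M@(suc _) x = begin
  (x % M ℕ.+ 1) % M              ≡⟨ ℕD.%-distribˡ-+ (x % M) 1 M ⟩
  (x % M % M ℕ.+ 1 % M) % M      ≡⟨ cong (λ y → (y ℕ.+ 1 % M) % M) (ℕD.m%n%n≡m%n x M) ⟩
  (x % M ℕ.+ 1 % M) % M          ≡⟨ ℕD.%-distribˡ-+ x 1 M ⟨
  (x ℕ.+ 1) % M                  ≡⟨ cong (_% M) (ℕP.+-comm x 1) ⟩
  suc x % M                      ∎
  where open ≡-Reasoning

module _ {n : ℕ} (e : Fin n) (es : List (Fin n)) where

  pick-∈ : ∀ x → pick e es x ∈ e ∷ es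
  pick-∈ x = ∈-lookup {xs = e ∷ es} (fromℕ< (ℕD.m%n<n x (suc (length es))))

  pick-lookup : ∀ {j} (j<d : j < suc (length es)) → pick e es j ≡ List.lookup (e ∷ es) (fromℕ< j<d)
  pick-lookup {j} j<d = cong (List.lookup (e ∷ es)) (FinP.fromℕ<-cong _ j (ℕD.m<n⇒m%n≡m j<d) _ j<d)

  pick-periodic : ∀ j → pick e es (suc (length es) ℕ.+ j) ≡ pick e es j
  pick-periodic j = cong (List.lookup (e ∷ es)) (FinP.fromℕ<-cong _ _ [d+j]%d≡j%d _ _)
    where
    d = suc (length es)
    [d+j]%d≡j%d : (d ℕ.+ j) % d ≡ j % d
    [d+j]%d≡j%d = trans (cong (_% d) (ℕP.+-comm d j)) (ℕD.[m+n]%n≡m%n j d)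

module _ {n : ℕ} (G : Graph n) (M : ℕ) .{{_ : NonZero M}} where

  counterWalk : ℕ → (Fin n → ℕ) → Fin n → (Fin n → ℕ) × Fin n
  counterWalk zero    U v = U , v
  counterWalk (suc f) U v with out G v
  ... | []     = U , v
  ... | e ∷ es = counterWalk f (update U v (suc (U v))) (pick e es (U v % M))

  walkOnce≗counterWalk : ∀ f R U v → R ≗ (_% M) ∘ U
    → proj₂ (walkOnceFuel G M Fwd f R v) ≡ proj₂ (counterWalk f U v)
    × proj₁ (walkOnceFuel G M Fwd f R v) ≗ (_% M) ∘ proj₁ (counterWalk f U v)
  walkOnce≗counterWalk zero    R U v R≗U%M = refl , R≗U%M
  walkOnce≗counterWalk (suc f) R U v R≗U%M with out G v
  ... | []     = refl , R≗U%M
  ... | e ∷ es rewrite R≗U%M v = walkOnce≗counterWalk f _ _ _ R′≗U′%M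
    where
    R′≗U′%M : update R v (incMod M (U v % M)) ≗ (_% M) ∘ update U v (suc (U v))
    R′≗U′%M w with w FinP.≟ v
    ... | yes _ = incMod-% M (U v)
    ... | no  _ = R≗U%M w

  Reaches : Fin n → Fin n → Set
  Reaches v u = v ≡ u ⊎ Path G v u

  counterWalk-unreached : ∀ f U v {u} → ¬ Reaches v u → proj₁ (counterWalk f U v) u ≡ U u
  counterWalk-unreached zero    U v ¬v⇝u = refl
  counterWalk-unreached (suc f) U v {u} ¬v⇝u with out G v in v→es
  ... | []     = refl
  ... | e ∷ es = trans (counterWalk-unreached f _ w ¬w⇝u) (update-≢ U (suc (U v)) (¬v⇝u ∘ inj₁ ∘ sym))
    where
    w = pick e es (U v % M)
    v→w : Edge G v w
    v→w = subst (w ∈_) (sym v→es) (pick-∈ e es (U v % M))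
    ¬w⇝u : ¬ Reaches w u
    ¬w⇝u (inj₁ refl) = ¬v⇝u (inj₂ (edge v→w))
    ¬w⇝u (inj₂ w⇝u)  = ¬v⇝u (inj₂ (v→w ◅ w⇝u))

  counterWalk-≤ : Acyclic G → ∀ f U v u → proj₁ (counterWalk f U v) u ℕ.≤ suc (U u)
  counterWalk-≤ acyclic zero    U v u = ℕP.n≤1+n (U u)
  counterWalk-≤ acyclic (suc f) U v u with out G v in v→es
  ... | []     = ℕP.n≤1+n (U u)
  ... | e ∷ es with u FinP.≟ v
  ...   | yes refl = ℕP.≤-reflexive (trans (counterWalk-unreached f _ w ¬w⇝u) (update-≡ U u (suc (U u))))
    where
    w = pick e es (U u % M)
    u→w : Edge G u w
    u→w = subst (w ∈_) (sym v→es) (pick-∈ e es (U u % M))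
    ¬w⇝u : ¬ Reaches w u
    ¬w⇝u (inj₁ w≡u)  = acyclic u (edge (subst (Edge G u) w≡u u→w))
    ¬w⇝u (inj₂ w⇝u)  = acyclic u (u→w ◅ w⇝u)
  ...   | no u≢v = ℕP.≤-trans (counterWalk-≤ acyclic f _ _ u) (s≤s (ℕP.≤-reflexive (update-≢ U (suc (U v)) u≢v)))

-- The potential

module _ {n : ℕ} (G : Graph n) (t : Fin n) (M : ℕ) .{{_ : NonZero M}} where

  gain : Fin n → ℕ → ℚ
  gain v r with out G v
  ... | []     = 0ℚ
  ... | e ∷ es = pReach G (pick e es r) t - pReach G v t

  gain-∷ : ∀ {v e es} → out G v ≡ e ∷ es → ∀ r → gain v r ≡ pReach G (pick e es r) t - pReach G v t
  gain-∷ {v} v→es r with out G v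
  gain-∷ refl r | _ ∷ _ = refl

  potential : Fin n → ℕ → ℚ
  potential v = sumTo (λ j → gain v (j % M))

  totalPotential : (Fin n → ℕ) → ℚ
  totalPotential U = sumℚ (map (λ w → potential w (U w)) (allFin n))

  totalPotential-step : ∀ U v → totalPotential (update U v (suc (U v))) ≡ totalPotential U + gain v (U v % M)
  totalPotential-step U v = sumℚ-map-update (allFin⁺ n) (∈-allFin v)
    (trans (cong (potential v) (update-≡ U v (suc (U v)))) (sumTo-suc (λ j → gain v (j % M)) (U v)))
    (λ {w} w≢v → cong (potential w) (update-≢ U (suc (U v)) w≢v))

  counterWalk-telescopes : ∀ {f v} → Halts G f v → ∀ U
    → indicator (proj₂ (counterWalk G M f U v)) t
      ≡ pReach G v t + (totalPotential (proj₁ (counterWalk G M f U v)) - totalPotential U)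
  counterWalk-telescopes {suc f} {v} (halts all-halt) U with out G v in v→es | all-halt
  ... | []     | _ = begin
    indicator v t                                    ≡⟨ reachProb-sink G t v→es n ⟨
    pReach G v t                                     ≡⟨ ℚP.+-identityʳ (pReach G v t) ⟨
    pReach G v t + 0ℚ                                ≡⟨ cong (_+_ (pReach G v t)) (ℚP.+-inverseʳ (totalPotential U)) ⟨
    pReach G v t + (totalPotential U - totalPotential U) ∎
    where open ≡-Reasoning
  ... | e ∷ es | all-halt′ = begin
    indicator (proj₂ W) t
      ≡⟨ counterWalk-telescopes (All.lookup all-halt′ (pick-∈ e es r)) U′ ⟩
    pReach G w t + (Ψ (proj₁ W) - Ψ U′)
      ≡⟨ cong (λ x → pReach G w t + (Ψ (proj₁ W) - x)) (totalPotential-step U v) ⟩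
    pReach G w t + (Ψ (proj₁ W) - (Ψ U + gain v r))
      ≡⟨ cong (λ x → pReach G w t + (Ψ (proj₁ W) - (Ψ U + x))) (gain-∷ v→es r) ⟩
    pReach G w t + (Ψ (proj₁ W) - (Ψ U + (pReach G w t - pReach G v t)))
      ≡⟨ telescope (pReach G w t) (pReach G v t) (Ψ (proj₁ W)) (Ψ U) ⟩
    pReach G v t + (Ψ (proj₁ W) - Ψ U) ∎
    where
    open ≡-Reasoning
    Ψ = totalPotential
    r = U v % M
    w = pick e es r
    U′ = update U v (suc (U v))
    W = counterWalk G M f U′ w
    telescope : ∀ hw hv ψ′ ψ → hw + (ψ′ - (ψ + (hw - hv))) ≡ hv + (ψ′ - ψ)
    telescope = solve-∀ ℚ-ring

  forwardPhase-suc : ∀ s k R → let (R′ , v) = walkOnce G M Fwd R s in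
    fromℕ (proj₂ (forwardPhase G M s t (suc k) R)) ≡ indicator v t + fromℕ (proj₂ (forwardPhase G M s t k R′))
  forwardPhase-suc s k R with proj₂ (walkOnce G M Fwd R s) FinP.≟ t
  ... | yes _ = fromℕ-+ 1 (proj₂ (forwardPhase G M s t k (proj₁ (walkOnce G M Fwd R s))))
  ... | no  _ = fromℕ-+ 0 (proj₂ (forwardPhase G M s t k (proj₁ (walkOnce G M Fwd R s))))

  counterRuns : Fin n → ℕ → (Fin n → ℕ) → (Fin n → ℕ)
  counterRuns s zero    U = U
  counterRuns s (suc k) U = counterRuns s k (proj₁ (counterWalk G M n U s))

  forwardPhase-count : Acyclic G → ∀ s k R U → R ≗ (_% M) ∘ U
    → fromℕ (proj₂ (forwardPhase G M s t k R))
      ≡ fromℕ k * pReach G s t + (totalPotential (counterRuns s k U) - totalPotential U)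
  forwardPhase-count acyclic s zero    R U R≗U%M = empty-run (pReach G s t) (totalPotential U)
    where
    empty-run : ∀ p ψ → 0ℚ ≡ 0ℚ * p + (ψ - ψ)
    empty-run = solve-∀ ℚ-ring
  forwardPhase-count acyclic s (suc k) R U R≗U%M = begin
    fromℕ (proj₂ (forwardPhase G M s t (suc k) R))
      ≡⟨ forwardPhase-suc s k R ⟩
    indicator (proj₂ W) t + fromℕ (proj₂ (forwardPhase G M s t k (proj₁ W)))
      ≡⟨ cong₂ _+_ (trans (cong (λ v → indicator v t) (proj₁ W≗C))
                          (counterWalk-telescopes (acyclic⇒halts G acyclic s) U))
                   (forwardPhase-count acyclic s k (proj₁ W) U′ (proj₂ W≗C)) ⟩
    (p + (Ψ U′ - Ψ U)) + (fromℕ k * p + (Ψ Uₖ - Ψ U′))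
      ≡⟨ regroup p (Ψ U′) (Ψ U) (fromℕ k) (Ψ Uₖ) ⟩
    (1ℚ + fromℕ k) * p + (Ψ Uₖ - Ψ U)
      ≡⟨ cong (λ x → x * p + (Ψ Uₖ - Ψ U)) (fromℕ-+ 1 k) ⟨
    fromℕ (suc k) * p + (Ψ Uₖ - Ψ U) ∎
    where
    open ≡-Reasoning
    Ψ = totalPotential
    p = pReach G s t
    W = walkOnce G M Fwd R s
    W≗C = walkOnce≗counterWalk G M n R U s R≗U%M
    U′ = proj₁ (counterWalk G M n U s)
    Uₖ = counterRuns s k U′
    regroup : ∀ p ψ′ ψ k ψₖ → (p + (ψ′ - ψ)) + (k * p + (ψₖ - ψ′)) ≡ (1ℚ + k) * p + (ψₖ - ψ)
    regroup = solve-∀ ℚ-ring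

  counterRuns-≤ : Acyclic G → ∀ s k U w → counterRuns s k U w ℕ.≤ U w ℕ.+ k
  counterRuns-≤ acyclic s zero    U w = ℕP.m≤m+n (U w) 0
  counterRuns-≤ acyclic s (suc k) U w = begin
    counterRuns s k U′ w    ≤⟨ counterRuns-≤ acyclic s k U′ w ⟩
    U′ w ℕ.+ k              ≤⟨ ℕP.+-monoˡ-≤ k (counterWalk-≤ G M acyclic n U s w) ⟩
    suc (U w) ℕ.+ k         ≡⟨ ℕP.+-suc (U w) k ⟨
    U w ℕ.+ suc k           ∎
    where
    open ℕP.≤-Reasoning
    U′ = proj₁ (counterWalk G M n U s)

  sumTo-pick≡d*pReach : Acyclic G → ∀ {v e es} → out G v ≡ e ∷ es
    → sumTo (λ j → pReach G (pick e es j) t) (suc (length es)) ≡ fromℕ (suc (length es)) * pReach G v t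
  sumTo-pick≡d*pReach acyclic {v} {e} {es} v→es = begin
    sumTo (λ j → pReach G (pick e es j) t) d
      ≡⟨ sumTo≡sumℚ-map (λ w → pReach G w t) (pick e es) (e ∷ es) (pick-lookup e es) ⟩
    S                   ≡⟨ ℚP.*-identityʳ S ⟨
    S * 1ℚ              ≡⟨ cong (S *_) (d*1/d≡1 (length es)) ⟨
    S * (fromℕ d * c)   ≡⟨ rearrange S (fromℕ d) c ⟩
    fromℕ d * (S * c)   ≡⟨ cong (fromℕ d *_) (pReach-harmonic G acyclic t v→es) ⟨
    fromℕ d * pReach G v t ∎
    where
    open ≡-Reasoning
    d = suc (length es)
    S = sumℚ (map (λ w → pReach G w t) (e ∷ es))
    c = + 1 / d
    rearrange : ∀ s d c → s * (d * c) ≡ d * (s * c)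
    rearrange = solve-∀ ℚ-ring

  ∣potential-∸∣≤2dout : Acyclic G → ∀ v {u₀ u₁} → u₀ < M → u₁ ℕ.≤ u₀ ℕ.+ M
                      → ∣ potential v u₁ - potential v u₀ ∣ ≤ fromℕ (2 ℕ.* dout G v)
  ∣potential-∸∣≤2dout acyclic v {u₀} {u₁} u₀<M u₁≤u₀+M with out G v in v→es
  ... | [] = subst₂ (λ p q → ∣ p - q ∣ ≤ 0ℚ) (sym (sumTo-zero u₁)) (sym (sumTo-zero u₀)) ℚP.≤-refl
  -- Once out G v is known, potential v unfolds to wrappedDeviation a μ M.
  ... | e ∷ es = ∣wrapped-∸∣≤2d a μ (suc (length es)) a-periodic (sumTo-pick≡d*pReach acyclic v→es)
                   (proj₁ ∘ a-bounds) (proj₂ ∘ a-bounds) (proj₁ (pReach-bounds v)) (proj₂ (pReach-bounds v))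
                   M u₀<M u₁≤u₀+M
    where
    a : ℕ → ℚ
    a j = pReach G (pick e es j) t
    μ = pReach G v t
    pReach-bounds : ∀ w → 0ℚ ≤ pReach G w t × pReach G w t ≤ 1ℚ
    pReach-bounds = reachProb-bounds G t n
    a-bounds : ∀ j → 0ℚ ≤ a j × a j ≤ 1ℚ
    a-bounds j = pReach-bounds (pick e es j)
    a-periodic : ∀ j → a (suc (length es) ℕ.+ j) ≡ a j
    a-periodic j = cong (λ w → pReach G w t) (pick-periodic e es j)

  ∣totalPotential-∸∣≤2m : Acyclic G → ∀ {U₀ U₁} → (∀ w → U₀ w < M) → (∀ w → U₁ w ℕ.≤ U₀ w ℕ.+ M)
                        → ∣ totalPotential U₁ - totalPotential U₀ ∣ ≤ fromℕ (2 ℕ.* edges G)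
  ∣totalPotential-∸∣≤2m acyclic {U₀} {U₁} U₀<M U₁≤U₀+M =
    subst (λ m → ∣ totalPotential U₁ - totalPotential U₀ ∣ ≤ fromℕ m) (sum-map-*ˡ 2 (dout G) (allFin n))
      (∣sumℚ-map-∸∣≤ (λ w → 2 ℕ.* dout G w)
         (λ w → ∣potential-∸∣≤2dout acyclic w (U₀<M w) (U₁≤U₀+M w)) (allFin n))

  forwardPhase-estimate : Acyclic G → ∀ s k R₀ → k ℕ.≤ M → (∀ w → R₀ w < M)
    → ∣ fromℕ (proj₂ (forwardPhase G M s t k R₀)) - fromℕ k * pReach G s t ∣ ≤ fromℕ (2 ℕ.* edges G)
  forwardPhase-estimate acyclic s k R₀ k≤M R₀<M = begin
    ∣ fromℕ N - fromℕ k * p ∣                ≡⟨ cong (λ x → ∣ x - fromℕ k * p ∣) count ⟩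
    ∣ (fromℕ k * p + Δ) - fromℕ k * p ∣      ≡⟨ cong ∣_∣ (cancel (fromℕ k * p) Δ) ⟩
    ∣ Δ ∣                                    ≤⟨ ∣totalPotential-∸∣≤2m acyclic R₀<M Uₖ≤R₀+M ⟩
    fromℕ (2 ℕ.* edges G)                    ∎
    where
    open ℚP.≤-Reasoning
    N = proj₂ (forwardPhase G M s t k R₀)
    p = pReach G s t
    Δ = totalPotential (counterRuns s k R₀) - totalPotential R₀
    count = forwardPhase-count acyclic s k R₀ R₀ (λ w → sym (ℕD.m<n⇒m%n≡m (R₀<M w)))
    cancel : ∀ x y → (x + y) - x ≡ y
    cancel = solve-∀ ℚ-ring
    Uₖ≤R₀+M : ∀ w → counterRuns s k R₀ w ℕ.≤ R₀ w ℕ.+ M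
    Uₖ≤R₀+M w = ℕP.≤-trans (counterRuns-≤ acyclic s k R₀ w) (ℕP.+-monoʳ-≤ (R₀ w) k≤M)

lemma4p5 : {n : ℕ} (G : Graph n) → Acyclic G → 0 < edges G
    → (s t : Fin n) → Sink G t
    → (ε : ℚ) (ε>0 : ε > 0ℚ)
    → (R₀ : Registers n) → ((v : Fin n) → R₀ v < 2 ^ ℓpar G ε ε>0)
    → ∣ walkValue G s t ε ε>0 R₀ - pReach G s t ∣ ≤ ε
lemma4p5 G acyclic 0<m s t _ ε ε>0 R₀ R₀<M = estimate K (n≤2^⌈log₂n⌉ K) 2m≤εK
  where
  K = Kpar G ε ε>0
  M = 2 ^ ℓpar G ε ε>0
  instance
    M-nonZero : NonZero M
    M-nonZero = ℕP.m^n≢0 2 (ℓpar G ε ε>0)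
  2m≤εK : fromℕ (2 ℕ.* edges G) ≤ ε * fromℕ K
  2m≤εK = x≤ε*∣ceiling[x÷ε]∣ ε>0 (fromℕ-nonNeg (2 ℕ.* edges G))
  1≰0 : ¬ (1ℚ ≤ 0ℚ)
  1≰0 1≤0 = ℚP.<-irrefl refl (ℚP.<-≤-trans (ℚP.positive⁻¹ 1ℚ) 1≤0)
  1≤2m : 1 ℕ.≤ 2 ℕ.* edges G
  1≤2m = ℕP.≤-trans 0<m (ℕP.m≤m+n (edges G) (edges G ℕ.+ 0))
  estimate : ∀ k → k ℕ.≤ M → fromℕ (2 ℕ.* edges G) ≤ ε * fromℕ k
           → ∣ ratio (proj₂ (forwardPhase G M s t k R₀)) k - pReach G s t ∣ ≤ ε
  estimate zero    _   2m≤0  = ⊥-elim (1≰0 (begin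
    1ℚ                     ≤⟨ fromℕ-mono-≤ 1≤2m ⟩
    fromℕ (2 ℕ.* edges G)  ≤⟨ 2m≤0 ⟩
    ε * 0ℚ                 ≡⟨ ℚP.*-zeroʳ ε ⟩
    0ℚ                     ∎))
    where open ℚP.≤-Reasoning
  estimate (suc k) k≤M 2m≤εk = ratio-error (proj₂ (forwardPhase G M s t (suc k) R₀)) k (pReach G s t) ε
    (ℚP.≤-trans (forwardPhase-estimate G t M acyclic s (suc k) R₀ k≤M R₀<M) 2m≤εk)
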